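{- Let $S,T$ be nonempty subsets of $\{1,\ldots,n-1\}$, let $s_1=\min S$, $t_1=\min T$, $d=\gcd\{s+t\mid s\in S,\ t\in T\}$ and $d'=\gcd(s_1,d)$. Then for any positive integer $i$: (a) $P_i=P_{i+d/d'}$; (b) the sets $P_i,P_{i+1},\ldots,P_{i-1+d/d'}$ are mutually disjoint; (c) if $i\ge2$, then $P_i=\{\ell\in\mathcal{I}_n\mid \ell-s_1\in P_{i-1}\text{ or }\ell+t_1\in P_{i-1}\}$.
   Context: $\mathcal{I}_n=\{ -n+1,\ldots,n-1\}$ (integers), and for a positive integer $i$, $P_i=\{\ell\in\mathcal{I}_n\mid \ell\equiv i s_1\pmod d\}$. -}

module Defs where

open import Data.Nat as ℕ using (ℕ)
open import Data.Nat.GCD using (gcd; gcd[m,n]∣n)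
open import Data.Nat.Divisibility using (quotient)
open import Data.Integer as ℤ using (ℤ; +_; -_; _-_)
open import Data.Integer.Divisibility using (_∣_)
open import Data.List using (List; foldr; concatMap; map)
open import Data.Product using (_×_)
open import Level using (0ℓ)
open import Relation.Unary using (Pred)

I : ℕ → Pred ℤ 0ℓ
I n ℓ = (- (+ n) ℤ.< ℓ) × (ℓ ℤ.< + n)

gcdList : List ℕ → ℕ
gcdList = foldr gcd 0

sums : List ℕ → List ℕ → List ℕ
sums S T = concatMap (λ s → map (λ t → s ℕ.+ t) T) S

dOf : List ℕ → List ℕ → ℕ
dOf S T = gcdList (sums S T)

-- d / d' where d' = gcd(s₁, d); computed as the quotient witnessing gcd(s₁,d) ∣ d
-- (so that  (d / d') * d' ≡ d  holds by construction)
ratio : ℕ → ℕ → ℕ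
ratio s₁ d = quotient (gcd[m,n]∣n s₁ d)

P : (n s₁ d i : ℕ) → Pred ℤ 0ℓ
P n s₁ d i ℓ = I n ℓ × ((+ d) ∣ (ℓ - + (i ℕ.* s₁)))

-- d' = gcd(s₁, d) and q = d / d' is the order of s₁ modulo d: d ∣ m·s₁ iff q ∣ m, because
-- d ∣ m·s₁ and d ∣ m·d give d ∣ gcd(m·s₁, m·d) = m·d' = m·d/q. Since P i consists of the points of
-- I_n in the residue class i·s₁ mod d, this gives (a) and (b). For (c), a point ℓ of P (i+1)
-- either stays in I_n after subtracting s₁, or lies so low that adding t₁ keeps it in I_n;
-- and adding t₁ does not change the class modulo d, since d ∣ s₁ + t₁.
module Submission where

open import Defs
open import Data.Nat using (ℕ; _+_; _∸_; _≤_; _<_)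
open import Data.Integer as ℤ using (+_)
open import Data.List using (List; [])
open import Data.List.Membership.Propositional using (_∈_)
open import Data.List.Relation.Unary.All using (All)
open import Data.Product using (_×_)
open import Data.Sum using (_⊎_)
open import Relation.Binary.PropositionalEquality using (_≢_)
open import Relation.Unary using (_≐_; _⊥_)

open import Data.Nat as ℕ using (NonZero; suc; _*_)
import Data.Nat.Properties as ℕ
open import Data.Nat.Divisibility as ℕ using (divides; ∣-trans; ∣n⇒∣m*n; ∣⇒≤; *-cancelʳ-∣)
open import Data.Nat.GCD using (gcd; gcd[m,n]∣m; gcd[m,n]∣n; gcd[m,n]≢0; gcd-greatest; c*gcd[m,n]≡gcd[cm,cn])
open import Algebra.Properties.CommutativeSemigroup ℕ.*-commutativeSemigroup using (x∙yz≈y∙xz)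
open import Data.Integer using (ℤ; _-_)
import Data.Integer.Properties as ℤ
open import Data.Integer.Divisibility using () renaming (_∣_ to _∣ℤ_)
import Data.Integer.Divisibility.Signed as Signed
open import Data.Integer.Tactic.RingSolver using (solve-∀)
open import Data.List using (_∷_; map; concatMap)
open import Data.List.Relation.Unary.Any using (Any; here; there)
open import Data.List.Relation.Unary.All using (lookup)
open import Data.List.Membership.Propositional.Properties using (∈-map⁺; ∈-concatMap⁺)
open import Data.Product using (_,_; proj₁; proj₂)
open import Data.Sum using (inj₁; inj₂)
open import Relation.Binary.Definitions using (tri<; tri≈; tri>)
open import Relation.Binary.PropositionalEquality using (_≡_; refl; sym; trans; cong; subst; subst₂; module ≡-Reasoning)
open import Relation.Nullary using (yes; no)

gcdList-∣ : ∀ {x xs} → x ∈ xs → gcdList xs ℕ.∣ x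
gcdList-∣ {xs = x ∷ xs} (here refl) = gcd[m,n]∣m x (gcdList xs)
gcdList-∣ {xs = y ∷ xs} (there x∈xs) = ∣-trans (gcd[m,n]∣n y (gcdList xs)) (gcdList-∣ x∈xs)

∈-sums : ∀ {s t S T} → s ∈ S → t ∈ T → s + t ∈ sums S T
∈-sums {T = T} s∈S t∈T = ∈-concatMap⁺ (λ s → map (λ t → s + t) T) (sum∈ s∈S)
  where
  sum∈ : ∀ {s S} → s ∈ S → Any (λ s′ → s + _ ∈ map (λ t → s′ + t) T) S
  sum∈ (here refl) = here (∈-map⁺ _ t∈T)
  sum∈ (there p) = there (sum∈ p)

dOf-∣-+ : ∀ {s t S T} → s ∈ S → t ∈ T → dOf S T ℕ.∣ s + t
dOf-∣-+ s∈S t∈T = gcdList-∣ (∈-sums s∈S t∈T)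

∣-ratio-* : ∀ m d → d ℕ.∣ ratio m d * m
∣-ratio-* m d = divides r (begin
    ratio m d * m        ≡⟨ cong (ratio m d *_) (ℕ._∣_.equality (gcd[m,n]∣m m d)) ⟩
    ratio m d * (r * g)  ≡⟨ x∙yz≈y∙xz (ratio m d) r g ⟩
    r * (ratio m d * g)  ≡⟨ cong (r *_) (ℕ._∣_.equality (gcd[m,n]∣n m d)) ⟨
    r * d                ∎)
  where
  open ≡-Reasoning
  g = gcd m d
  r = ℕ._∣_.quotient (gcd[m,n]∣m m d)

ratio-∣ : ∀ m d {k} .{{_ : NonZero m}} → d ℕ.∣ k * m → ratio m d ℕ.∣ k
ratio-∣ m d {k} d∣km = *-cancelʳ-∣ (gcd m d) {{ℕ.≢-nonZero g≢0}} d'∣kg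
  where
  g≢0 : gcd m d ≢ 0
  g≢0 = gcd[m,n]≢0 m d (inj₁ (ℕ.≢-nonZero⁻¹ m))
  d∣kg : d ℕ.∣ k * gcd m d
  d∣kg = subst (d ℕ.∣_) (sym (c*gcd[m,n]≡gcd[cm,cn] k m d))
           (gcd-greatest d∣km (∣n⇒∣m*n k ℕ.∣-refl))
  d'∣kg : ratio m d * gcd m d ℕ.∣ k * gcd m d
  d'∣kg = subst (ℕ._∣ k * gcd m d) (ℕ._∣_.equality (gcd[m,n]∣n m d)) d∣kg

ratio-minimal : ∀ m d {k} .{{_ : NonZero m}} → 0 < k → d ℕ.∣ k * m → ratio m d ≤ k
ratio-minimal m d 0<k d∣km = ∣⇒≤ {{ℕ.>-nonZero 0<k}} (ratio-∣ m d d∣km)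

∣m∣n⇒∣m+n : ∀ {d} m n → + d ∣ℤ m → + d ∣ℤ n → + d ∣ℤ m ℤ.+ n
∣m∣n⇒∣m+n {d} m n d∣m d∣n = Signed.∣⇒∣ᵤ {+ d} {m ℤ.+ n}
  (Signed.∣m∣n⇒∣m+n (Signed.∣ᵤ⇒∣ {+ d} {m} d∣m) (Signed.∣ᵤ⇒∣ {+ d} {n} d∣n))

∣m+n∣m⇒∣n : ∀ {d} m n → + d ∣ℤ m ℤ.+ n → + d ∣ℤ m → + d ∣ℤ n
∣m+n∣m⇒∣n {d} m n d∣m+n d∣m = Signed.∣⇒∣ᵤ {+ d} {n}
  (Signed.∣m+n∣m⇒∣n (Signed.∣ᵤ⇒∣ {+ d} {m ℤ.+ n} d∣m+n) (Signed.∣ᵤ⇒∣ {+ d} {m} d∣m))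

∣m+n∣n⇒∣m : ∀ {d} m n → + d ∣ℤ m ℤ.+ n → + d ∣ℤ n → + d ∣ℤ m
∣m+n∣n⇒∣m {d} m n d∣m+n d∣n = Signed.∣⇒∣ᵤ {+ d} {m}
  (Signed.∣m+n∣n⇒∣m (Signed.∣ᵤ⇒∣ {+ d} {m ℤ.+ n} d∣m+n) (Signed.∣ᵤ⇒∣ {+ d} {n} d∣n))

I-step : ∀ {n s t ℓ} → s < n → t < n → I n ℓ → I n (ℓ - + s) ⊎ I n (ℓ ℤ.+ + t)
I-step {n} {s} {t} {ℓ} s<n t<n (-n<ℓ , ℓ<n) with ℤ.- + n ℤ.<? ℓ - + s
... | yes -n<ℓ-s = inj₁ (-n<ℓ-s , ℤ.≤-<-trans (ℤ.i-j≤i ℓ (+ s)) ℓ<n)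
... | no -n≮ℓ-s = inj₂ (ℤ.<-≤-trans -n<ℓ (ℤ.i≤i+j ℓ (+ t)) , ℓ+t<n)
  where
  split-+ : ∀ ℓ s t → ℓ ℤ.+ t ≡ (ℓ - s) ℤ.+ (s ℤ.+ t)
  split-+ = solve-∀
  -n+2n≡n : ∀ n → ℤ.- n ℤ.+ (n ℤ.+ n) ≡ n
  -n+2n≡n = solve-∀
  ℓ+t<n : ℓ ℤ.+ + t ℤ.< + n
  ℓ+t<n = subst₂ ℤ._<_ (sym (split-+ ℓ (+ s) (+ t))) (-n+2n≡n (+ n))
            (ℤ.+-mono-≤-< (ℤ.≮⇒≥ -n≮ℓ-s) (ℤ.+<+ (ℕ.+-mono-< s<n t<n)))

module _ {n s₁ d : ℕ} where

  shift-by : ∀ i m ℓ → ℓ - + (i * s₁) ≡ (ℓ - + ((i + m) * s₁)) ℤ.+ + (m * s₁)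
  shift-by i m ℓ = begin
    ℓ - + (i * s₁)                                  ≡⟨ -+-cancel ℓ (+ (i * s₁)) (+ (m * s₁)) ⟩
    (ℓ - + (i * s₁ + m * s₁)) ℤ.+ + (m * s₁)        ≡⟨ cong (λ a → (ℓ - + a) ℤ.+ + (m * s₁)) (ℕ.*-distribʳ-+ s₁ i m) ⟨
    (ℓ - + ((i + m) * s₁)) ℤ.+ + (m * s₁)           ∎
    where
    open ≡-Reasoning
    -+-cancel : ∀ ℓ a b → ℓ - a ≡ (ℓ - (a ℤ.+ b)) ℤ.+ b
    -+-cancel = solve-∀

  P-periodic : ∀ {m} → d ℕ.∣ m * s₁ → ∀ i → P n s₁ d i ≐ P n s₁ d (i + m)
  P-periodic {m} d∣ms i = forward , backward
    where
    forward : ∀ {ℓ} → P n s₁ d i ℓ → P n s₁ d (i + m) ℓ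
    forward {ℓ} (ℓ∈I , d∣) = ℓ∈I ,
      ∣m+n∣n⇒∣m (ℓ - + ((i + m) * s₁)) (+ (m * s₁)) (subst (+ d ∣ℤ_) (shift-by i m ℓ) d∣) d∣ms
    backward : ∀ {ℓ} → P n s₁ d (i + m) ℓ → P n s₁ d i ℓ
    backward {ℓ} (ℓ∈I , d∣) = ℓ∈I , subst (+ d ∣ℤ_) (sym (shift-by i m ℓ))
      (∣m∣n⇒∣m+n (ℓ - + ((i + m) * s₁)) (+ (m * s₁)) d∣ d∣ms)

  P-overlap : ∀ {i m ℓ} → P n s₁ d i ℓ → P n s₁ d (i + m) ℓ → d ℕ.∣ m * s₁
  P-overlap {i} {m} {ℓ} (_ , d∣) (_ , d∣′) =
    ∣m+n∣m⇒∣n (ℓ - + ((i + m) * s₁)) (+ (m * s₁)) (subst (+ d ∣ℤ_) (shift-by i m ℓ) d∣) d∣′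

  P-disjoint-< : .{{_ : NonZero s₁}} → ∀ i {j k} → j < k → k < ratio s₁ d →
                 P n s₁ d (i + j) ⊥ P n s₁ d (i + k)
  P-disjoint-< i {j} {k} j<k k<q {ℓ} (ℓ∈Pj , ℓ∈Pk) =
    ℕ.<⇒≱ (ℕ.≤-<-trans (ℕ.m∸n≤m k j) k<q)
          (ratio-minimal s₁ d (ℕ.m<n⇒0<n∸m j<k) (P-overlap {i + j} ℓ∈Pj ℓ∈Pk′))
    where
    i+k≡i+j+[k∸j] : i + k ≡ (i + j) + (k ∸ j)
    i+k≡i+j+[k∸j] = trans (cong (λ x → i + x) (sym (ℕ.m+[n∸m]≡n (ℕ.<⇒≤ j<k))))
                          (sym (ℕ.+-assoc i j (k ∸ j)))
    ℓ∈Pk′ : P n s₁ d ((i + j) + (k ∸ j)) ℓ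
    ℓ∈Pk′ = subst (λ x → P n s₁ d x ℓ) i+k≡i+j+[k∸j] ℓ∈Pk

  P-disjoint : .{{_ : NonZero s₁}} → ∀ i j k → j < ratio s₁ d → k < ratio s₁ d → j ≢ k →
               P n s₁ d (i + j) ⊥ P n s₁ d (i + k)
  P-disjoint i j k j<q k<q j≢k with ℕ.<-cmp j k
  ... | tri< j<k _ _ = P-disjoint-< i j<k k<q
  ... | tri≈ _ j≡k _ = λ _ → j≢k j≡k
  ... | tri> _ _ k<j = λ (ℓ∈Pj , ℓ∈Pk) → P-disjoint-< i k<j j<q (ℓ∈Pk , ℓ∈Pj)

  P-suc : ∀ t₁ → d ℕ.∣ s₁ + t₁ → s₁ < n → t₁ < n → ∀ i →
          P n s₁ d (suc i) ≐ (λ ℓ → I n ℓ × (P n s₁ d i (ℓ - + s₁) ⊎ P n s₁ d i (ℓ ℤ.+ + t₁)))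
  P-suc t₁ d∣s+t s<n t<n i = split , merge
    where
    a = + (i * s₁)
    -+-assoc : ∀ ℓ s a → ℓ - (s ℤ.+ a) ≡ (ℓ - s) - a
    -+-assoc = solve-∀
    swap-step : ∀ ℓ s t a → (ℓ ℤ.+ t) - a ≡ (ℓ - (s ℤ.+ a)) ℤ.+ (s ℤ.+ t)
    swap-step = solve-∀
    split : ∀ {ℓ} → P n s₁ d (suc i) ℓ → I n ℓ × (P n s₁ d i (ℓ - + s₁) ⊎ P n s₁ d i (ℓ ℤ.+ + t₁))
    split {ℓ} (ℓ∈I , d∣) with I-step s<n t<n ℓ∈I
    ... | inj₁ ℓ-s∈I = ℓ∈I , inj₁ (ℓ-s∈I , subst (+ d ∣ℤ_) (-+-assoc ℓ (+ s₁) a) d∣)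
    ... | inj₂ ℓ+t∈I = ℓ∈I , inj₂ (ℓ+t∈I , subst (+ d ∣ℤ_) (sym (swap-step ℓ (+ s₁) (+ t₁) a))
                                          (∣m∣n⇒∣m+n (ℓ - (+ s₁ ℤ.+ a)) (+ (s₁ + t₁)) d∣ d∣s+t))
    merge : ∀ {ℓ} → I n ℓ × (P n s₁ d i (ℓ - + s₁) ⊎ P n s₁ d i (ℓ ℤ.+ + t₁)) → P n s₁ d (suc i) ℓ
    merge {ℓ} (ℓ∈I , inj₁ (_ , d∣)) = ℓ∈I , subst (+ d ∣ℤ_) (sym (-+-assoc ℓ (+ s₁) a)) d∣
    merge {ℓ} (ℓ∈I , inj₂ (_ , d∣)) = ℓ∈I , ∣m+n∣n⇒∣m (ℓ - (+ s₁ ℤ.+ a)) (+ (s₁ + t₁))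
                                          (subst (+ d ∣ℤ_) (swap-step ℓ (+ s₁) (+ t₁) a) d∣) d∣s+t

lemma2p8 : (n : ℕ) (S T : List ℕ) →
    S ≢ [] → T ≢ [] →
    All (λ s → 1 ≤ s × s < n) S → All (λ t → 1 ≤ t × t < n) T →
    (s₁ t₁ : ℕ) →
    s₁ ∈ S → (∀ {s} → s ∈ S → s₁ ≤ s) →
    t₁ ∈ T → (∀ {t} → t ∈ T → t₁ ≤ t) →
    let d = dOf S T
        q = ratio s₁ d
    in (i : ℕ) → 1 ≤ i →
      (P n s₁ d i ≐ P n s₁ d (i + q))
      × (∀ j k → j < q → k < q → j ≢ k → P n s₁ d (i + j) ⊥ P n s₁ d (i + k))
      × (2 ≤ i → P n s₁ d i ≐ (λ ℓ → I n ℓ × (P n s₁ d (i ∸ 1) (ℓ ℤ.- + s₁) ⊎ P n s₁ d (i ∸ 1) (ℓ ℤ.+ + t₁))))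
lemma2p8 n S T _ _ S-bounds T-bounds s₁ t₁ s₁∈S _ t₁∈T _ i 1≤i =
    P-periodic (∣-ratio-* s₁ d) i
  , P-disjoint {{ℕ.>-nonZero 0<s₁}} i
  , λ _ → P-pred 1≤i
  where
  d = dOf S T
  0<s₁ = proj₁ (lookup S-bounds s₁∈S)
  P-pred : ∀ {i} → 1 ≤ i →
           P n s₁ d i ≐ (λ ℓ → I n ℓ × (P n s₁ d (i ∸ 1) (ℓ - + s₁) ⊎ P n s₁ d (i ∸ 1) (ℓ ℤ.+ + t₁)))
  P-pred {suc i} _ =
    P-suc t₁ (dOf-∣-+ s₁∈S t₁∈T) (proj₂ (lookup S-bounds s₁∈S)) (proj₂ (lookup T-bounds t₁∈T)) i
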